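{- Let $n$ be a positive integer and $\vec n\in\mathcal H(n)$. (i) Every maximal sequence of successive single-step reductions starting at $\vec n$ ends with the binary expansion $\vec n''$ of $n$. (ii) Every maximal sequence of successive inverse single-step reductions starting at $\vec n$ ends with the expansion $\vec n'\in\mathcal H(n)$ having no digit $0$. (iii) The minimal and maximal elements of $\mathcal H(n)$ with respect to the shortlex order $<_{SL}$ are $\vec n'$ and $\vec n''$ respectively.
   Context: A hyperbinary expansion of a positive integer $n$ is a word $x_1\cdots x_k$ over $\{0,1,2\}$ with $x_1\neq 0$ and $n=\sum_{i=1}^k x_i2^{k-i}$; $\mathcal H(n)$ is the set of these. $\vec n'$ is the unique element of $\mathcal H(n)$ with no digit $0$; $\vec n''$ is the binary expansion (unique element with digits in $\{0,1\}$). Words are regarded up to leading zeros. Single-step reductions are: (I) $2\vec y \to 1\,0\,\vec y$; (II) $\vec x\,0\,2\,\vec y\to \vec x\,1\,0\,\vec y$; (III) $\vec x\,1\,2\,\vec y \twoheadrightarrow \vec x\,2\,0\,\vec y$, for words $\vec x,\vec y$ over $\{0,1,2\}$; inverse single-step reductions are the reverse rewritings ($1\,0\to 0\,2$ resp. $1\,0\,\vec y\to 2\,\vec y$ at the front, and $2\,0\to 1\,2$). $<_{SL}$ is the shortlex order: words are compared first by length (shorter first), then lexicographically with $0<1<2$. -}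

module Defs where

open import Data.Nat using (ℕ; zero; suc; _+_; _*_; _<_)
open import Data.List using (List; []; _∷_; _++_; length; foldl)
open import Data.List.Relation.Unary.All using (All)
open import Data.Product using (_×_)
open import Data.Sum using (_⊎_)
open import Relation.Nullary using (¬_)
open import Relation.Binary.PropositionalEquality using (_≡_; _≢_)

data Digit : Set where
  d0 d1 d2 : Digit

digitVal : Digit → ℕ
digitVal d0 = 0
digitVal d1 = 1
digitVal d2 = 2

-- Words over {0,1,2}, most significant digit first: x₁ ⋯ xₖ
Word : Set
Word = List Digit

value : Word → ℕ
value = foldl (λ acc d → 2 * acc + digitVal d) 0

data LeadNZ : Word → Set where
  lead1 : ∀ {y} → LeadNZ (d1 ∷ y)
  lead2 : ∀ {y} → LeadNZ (d2 ∷ y)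

IsHyper : ℕ → Word → Set
IsHyper n w = LeadNZ w × value w ≡ n

NoZero : Word → Set
NoZero = All (_≢ d0)

Binary : Word → Set
Binary = All (_≢ d2)

-- Single-step reductions on words written without leading zeros.
-- (II) with x empty acts on 0 2 y ≅ 2 y and coincides with (I); it is
-- therefore only listed for nonempty x (so no leading zeros arise).
data _⟶_ : Word → Word → Set where
  stepI   : ∀ y → (d2 ∷ y) ⟶ (d1 ∷ d0 ∷ y)
  stepII  : ∀ a x y → ((a ∷ x) ++ d0 ∷ d2 ∷ y) ⟶ ((a ∷ x) ++ d1 ∷ d0 ∷ y)
  stepIII : ∀ x y → (x ++ d1 ∷ d2 ∷ y) ⟶ (x ++ d2 ∷ d0 ∷ y)

_⟶⁻_ : Word → Word → Set
u ⟶⁻ v = v ⟶ u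

Irreducible : (Word → Word → Set) → Word → Set
Irreducible R w = ∀ v → ¬ R w v

_<D_ : Digit → Digit → Set
a <D b = digitVal a < digitVal b

data _<Lex_ : Word → Word → Set where
  here  : ∀ {a b xs ys} → a <D b → (a ∷ xs) <Lex (b ∷ ys)
  there : ∀ {a xs ys} → xs <Lex ys → (a ∷ xs) <Lex (a ∷ ys)

_<SL_ : Word → Word → Set
u <SL v = length u < length v ⊎ (length u ≡ length v × u <Lex v)

_≤SL_ : Word → Word → Set
u ≤SL v = u ≡ v ⊎ u <SL v

-- Every reduction keeps the value of a word and lowers its digit sum by one,
-- while the digit sum never exceeds the value; so reductions and inverse
-- reductions both terminate. Scanning a word for its first digit 2 (resp. 0)
-- always exposes a redex, so the irreducible words are exactly the binary
-- (resp. zero-free) ones, and these are unique in 𝓗(n) because the last digit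
-- of such an expansion is determined by the parity of n. They exist: raising
-- the last digit of n⃗″ gives an expansion of n + 1, which reduces to a binary
-- one. Finally each reduction strictly increases a word in shortlex order, so
-- every w ∈ 𝓗(n) reduces to n⃗″ and reduces inversely to n⃗′, giving
-- n⃗′ ≤ w ≤ n⃗″.
module Submission where

open import Defs
open import Data.Empty using (⊥; ⊥-elim)
open import Data.List using ([]; _∷_; _++_; _∷ʳ_; foldl; map; head; initLast; _∷ʳ′_)
open import Data.List.Properties using (foldl-++; foldl-∷ʳ; length-++; map-++)
open import Data.List.Relation.Unary.All using (All; []; _∷_)
open import Data.List.Relation.Unary.All.Properties using (∷ʳ⁻)
open import Data.List.Reverse using (Reverse; []; _∶_∶ʳ_; reverseView)
open import Data.Maybe using (just)
open import Data.Nat using (ℕ; zero; suc; _+_; _*_; _∸_; _≤_; _<_; s≤s; z≤n)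
open import Data.Nat.Induction using (<-wellFounded)
open import Data.Nat.ListAction using (sum)
open import Data.Nat.ListAction.Properties using (sum-++)
open import Data.Nat.Properties
  using ( ≤-reflexive; ≤-trans; +-monoˡ-≤; m≤m+n; +-assoc; +-suc; +-comm
        ; +-identityʳ; n<1+n; <-trans; ∸-monoʳ-<; *-cancelˡ-≡; +-cancelʳ-≡; even≢odd
        ; module ≤-Reasoning)
open import Data.Nat.Tactic.RingSolver using (solve-∀)
open import Data.Product using (_×_; Σ; _,_; -,_; ∃-syntax; proj₁; proj₂)
open import Data.Sum using (_⊎_; inj₁; inj₂)
import Data.Sum as Sum
open import Function using (flip; _∘_; id)
open import Induction.WellFounded using (Acc; acc; WellFounded; module Subrelation)
open import Relation.Binary.Construct.Closure.ReflexiveTransitive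
  using (Star; ε; _◅_; fold; reverse)
import Relation.Binary.Construct.On as On
open import Relation.Binary.Definitions using (DecidableEquality)
open import Relation.Nullary using (¬_; yes; no; ¬?)
open import Relation.Unary using (Decidable)
open import Relation.Binary.PropositionalEquality
  using (_≡_; _≢_; refl; sym; trans; cong; cong₂; subst; subst₂; module ≡-Reasoning)

_≟_ : DecidableEquality Digit
d0 ≟ d0 = yes refl
d1 ≟ d1 = yes refl
d2 ≟ d2 = yes refl
d0 ≟ d1 = no λ ()
d0 ≟ d2 = no λ ()
d1 ≟ d0 = no λ ()
d1 ≟ d2 = no λ ()
d2 ≟ d0 = no λ ()
d2 ≟ d1 = no λ ()

lead-nonzero : ∀ {c t} → c ≢ d0 → LeadNZ (c ∷ t)
lead-nonzero {d0} c≢0 = ⊥-elim (c≢0 refl)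
lead-nonzero {d1} _ = lead1
lead-nonzero {d2} _ = lead2

nonzero-lead : ∀ {c t} → LeadNZ (c ∷ t) → c ≢ d0
nonzero-lead lead1 ()
nonzero-lead lead2 ()

push : ℕ → Digit → ℕ
push a d = 2 * a + digitVal d

value-++ : ∀ x y → value (x ++ y) ≡ foldl push (value x) y
value-++ = foldl-++ push 0

value-∷ʳ : ∀ xs d → value (xs ∷ʳ d) ≡ 2 * value xs + digitVal d
value-∷ʳ xs d = foldl-∷ʳ push 0 d xs

value-replace : ∀ x {c d c′ d′} y → (∀ a → push (push a c) d ≡ push (push a c′) d′) →
                value (x ++ c ∷ d ∷ y) ≡ value (x ++ c′ ∷ d′ ∷ y)
value-replace x {c} {d} {c′} {d′} y local = begin
  value (x ++ c ∷ d ∷ y)                   ≡⟨ value-++ x _ ⟩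
  foldl push (push (push (value x) c) d) y ≡⟨ cong (λ a → foldl push a y) (local (value x)) ⟩
  foldl push (push (push (value x) c′) d′) y ≡⟨ value-++ x _ ⟨
  value (x ++ c′ ∷ d′ ∷ y)                 ∎
  where open ≡-Reasoning

digitSum : Word → ℕ
digitSum = sum ∘ map digitVal

digitSum-++ : ∀ x y → digitSum (x ++ y) ≡ digitSum x + digitSum y
digitSum-++ x y = trans (cong sum (map-++ digitVal x y)) (sum-++ (map digitVal x) _)

digitSum-replace : ∀ x {c d c′ d′} y → digitSum (c ∷ d ∷ y) ≡ suc (digitSum (c′ ∷ d′ ∷ y)) →
                   digitSum (x ++ c ∷ d ∷ y) ≡ suc (digitSum (x ++ c′ ∷ d′ ∷ y))
digitSum-replace x {c} {d} {c′} {d′} y local = begin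
  digitSum (x ++ c ∷ d ∷ y)                   ≡⟨ digitSum-++ x _ ⟩
  digitSum x + digitSum (c ∷ d ∷ y)           ≡⟨ cong (digitSum x +_) local ⟩
  digitSum x + suc (digitSum (c′ ∷ d′ ∷ y))   ≡⟨ +-suc (digitSum x) _ ⟩
  suc (digitSum x + digitSum (c′ ∷ d′ ∷ y))   ≡⟨ cong suc (digitSum-++ x _) ⟨
  suc (digitSum (x ++ c′ ∷ d′ ∷ y))           ∎
  where open ≡-Reasoning

+digitSum≤foldl : ∀ a w → a + digitSum w ≤ foldl push a w
+digitSum≤foldl a [] = ≤-reflexive (+-identityʳ a)
+digitSum≤foldl a (d ∷ w) = begin
  a + (digitVal d + digitSum w) ≡⟨ +-assoc a _ _ ⟨
  a + digitVal d + digitSum w   ≤⟨ +-monoˡ-≤ _ (+-monoˡ-≤ _ (m≤m+n a (a + 0))) ⟩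
  push a d + digitSum w         ≤⟨ +digitSum≤foldl (push a d) w ⟩
  foldl push (push a d) w       ∎
  where open ≤-Reasoning

digitSum≤value : ∀ w → digitSum w ≤ value w
digitSum≤value = +digitSum≤foldl 0

value≡0⇒[] : ∀ w → head w ≢ just d0 → value w ≡ 0 → w ≡ []
value≡0⇒[] [] _ _ = refl
value≡0⇒[] (d0 ∷ t) h _ = ⊥-elim (h refl)
value≡0⇒[] (d1 ∷ t) _ e with () ← subst (1 ≤_) e (≤-trans (m≤m+n 1 _) (+digitSum≤foldl 1 t))
value≡0⇒[] (d2 ∷ t) _ e with () ← subst (2 ≤_) e (≤-trans (m≤m+n 2 _) (+digitSum≤foldl 2 t))

0·2≡1·0 : ∀ a → 2 * (2 * a + 0) + 2 ≡ 2 * (2 * a + 1) + 0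
0·2≡1·0 = solve-∀

1·2≡2·0 : ∀ a → 2 * (2 * a + 1) + 2 ≡ 2 * (2 * a + 2) + 0
1·2≡2·0 = solve-∀

⟶-value : ∀ {w v} → w ⟶ v → value w ≡ value v
⟶-value (stepI y) = refl
⟶-value (stepII a x y) = value-replace (a ∷ x) y 0·2≡1·0
⟶-value (stepIII x y) = value-replace x y 1·2≡2·0

⟶-digitSum : ∀ {w v} → w ⟶ v → digitSum w ≡ suc (digitSum v)
⟶-digitSum (stepI y) = refl
⟶-digitSum (stepII a x y) = digitSum-replace (a ∷ x) y refl
⟶-digitSum (stepIII x y) = digitSum-replace x y refl

⟶-lead : ∀ {w v} → w ⟶ v → LeadNZ w → LeadNZ v
⟶-lead (stepI y) _ = lead1
⟶-lead (stepII a x y) l = lead-nonzero (nonzero-lead l)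
⟶-lead (stepIII [] y) _ = lead2
⟶-lead (stepIII (b ∷ x) y) l = lead-nonzero (nonzero-lead l)

⟵-lead : ∀ {w v} → w ⟶ v → LeadNZ v → LeadNZ w
⟵-lead (stepI y) _ = lead2
⟵-lead (stepII a x y) l = lead-nonzero (nonzero-lead l)
⟵-lead (stepIII [] y) _ = lead1
⟵-lead (stepIII (b ∷ x) y) l = lead-nonzero (nonzero-lead l)

⟶-IsHyper : ∀ {n w v} → w ⟶ v → IsHyper n w → IsHyper n v
⟶-IsHyper st (l , e) = ⟶-lead st l , trans (sym (⟶-value st)) e

⟵-IsHyper : ∀ {n w v} → w ⟶ v → IsHyper n v → IsHyper n w
⟵-IsHyper st (l , e) = ⟵-lead st l , trans (⟶-value st) e

⟶-wellFounded : WellFounded (flip _⟶_)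
⟶-wellFounded = Subrelation.wellFounded digitSum-decreases (On.wellFounded digitSum <-wellFounded)
  where
  digitSum-decreases : ∀ {v w} → w ⟶ v → digitSum v < digitSum w
  digitSum-decreases st = ≤-reflexive (sym (⟶-digitSum st))

slack : Word → ℕ
slack w = value w ∸ digitSum w

⟶-slack : ∀ {w v} → w ⟶ v → slack w < slack v
⟶-slack {w} {v} st = begin-strict
  value w ∸ digitSum w       ≡⟨ cong₂ _∸_ (⟶-value st) (⟶-digitSum st) ⟩
  value v ∸ suc (digitSum v) <⟨ ∸-monoʳ-< (n<1+n _) bound ⟩
  value v ∸ digitSum v       ∎
  where
  open ≤-Reasoning
  bound : suc (digitSum v) ≤ value v
  bound = subst₂ _≤_ (⟶-digitSum st) (⟶-value st) (digitSum≤value w)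

⟶⁻-wellFounded : WellFounded (flip _⟶⁻_)
⟶⁻-wellFounded = Subrelation.wellFounded ⟶-slack (On.wellFounded slack <-wellFounded)

<Lex-trans : ∀ {u v w} → u <Lex v → v <Lex w → u <Lex w
<Lex-trans (here p) (here q) = here (<-trans p q)
<Lex-trans (here p) (there q) = here p
<Lex-trans (there p) (here q) = here q
<Lex-trans (there p) (there q) = there (<Lex-trans p q)

<Lex-++ˡ : ∀ x {s t} → s <Lex t → (x ++ s) <Lex (x ++ t)
<Lex-++ˡ [] p = p
<Lex-++ˡ (a ∷ x) p = there (<Lex-++ˡ x p)

<SL-trans : ∀ {u v w} → u <SL v → v <SL w → u <SL w
<SL-trans (inj₁ p) (inj₁ q) = inj₁ (<-trans p q)
<SL-trans (inj₁ p) (inj₂ (e , _)) = inj₁ (subst (_ <_) e p)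
<SL-trans (inj₂ (e , _)) (inj₁ q) = inj₁ (subst (_< _) (sym e) q)
<SL-trans (inj₂ (e , p)) (inj₂ (e′ , q)) = inj₂ (trans e e′ , <Lex-trans p q)

≤SL-trans : ∀ {u v w} → u ≤SL v → v ≤SL w → u ≤SL w
≤SL-trans (inj₁ refl) q = q
≤SL-trans (inj₂ p) (inj₁ refl) = inj₂ p
≤SL-trans (inj₂ p) (inj₂ q) = inj₂ (<SL-trans p q)

<SL-replace : ∀ x {c d c′ d′} y → c <D c′ → (x ++ c ∷ d ∷ y) <SL (x ++ c′ ∷ d′ ∷ y)
<SL-replace x y c<c′ = inj₂ (trans (length-++ x) (sym (length-++ x)) , <Lex-++ˡ x (here c<c′))

⟶⇒<SL : ∀ {w v} → w ⟶ v → w <SL v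
⟶⇒<SL (stepI y) = inj₁ (n<1+n _)
⟶⇒<SL (stepII a x y) = <SL-replace (a ∷ x) y (s≤s z≤n)
⟶⇒<SL (stepIII x y) = <SL-replace x y (s≤s (s≤s z≤n))

⟶*⇒≤SL : ∀ {w v} → Star _⟶_ w v → w ≤SL v
⟶*⇒≤SL = fold _≤SL_ (λ st → ≤SL-trans (inj₂ (⟶⇒<SL st))) (inj₁ refl)

data Violation (P : Digit → Set) : Word → Set where
  violation : ∀ x {c d} y → P c → ¬ P d → Violation P (x ++ c ∷ d ∷ y)

∷-violation : ∀ {P} c {w} → Violation P w → Violation P (c ∷ w)
∷-violation c (violation x y pc ¬pd) = violation (c ∷ x) y pc ¬pd

all-or-violation : ∀ {P} → Decidable P → ∀ {c} t → P c → All P (c ∷ t) ⊎ Violation P (c ∷ t)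
all-or-violation P? [] pc = inj₁ (pc ∷ [])
all-or-violation P? {c} (d ∷ t) pc with P? d
... | no ¬pd = inj₂ (violation [] t pc ¬pd)
... | yes pd = Sum.map (pc ∷_) (∷-violation c) (all-or-violation P? t pd)

violation-reducible : ∀ {w} → Violation (_≢ d2) w → LeadNZ w → ∃[ v ] w ⟶ v
violation-reducible (violation [] {d0} {d2} y _ _) ()
violation-reducible (violation (a ∷ x) {d0} {d2} y _ _) _ = -, stepII a x y
violation-reducible (violation x {d1} {d2} y _ _) _ = -, stepIII x y
violation-reducible (violation x {d2} y 2≢2 _) _ = ⊥-elim (2≢2 refl)
violation-reducible (violation x {d = d0} y _ ¬0≢2) _ = ⊥-elim (¬0≢2 λ ())
violation-reducible (violation x {d = d1} y _ ¬1≢2) _ = ⊥-elim (¬1≢2 λ ())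

violation-coreducible : ∀ {w} → Violation (_≢ d0) w → ∃[ v ] v ⟶ w
violation-coreducible (violation [] {d1} {d0} y _ _) = -, stepI y
violation-coreducible (violation (a ∷ x) {d1} {d0} y _ _) = -, stepII a x y
violation-coreducible (violation x {d2} {d0} y _ _) = -, stepIII x y
violation-coreducible (violation x {d0} y 0≢0 _) = ⊥-elim (0≢0 refl)
violation-coreducible (violation x {d = d1} y _ ¬1≢0) = ⊥-elim (¬1≢0 λ ())
violation-coreducible (violation x {d = d2} y _ ¬2≢0) = ⊥-elim (¬2≢0 λ ())

binary-or-reducible : ∀ {w} → LeadNZ w → Binary w ⊎ ∃[ v ] w ⟶ v
binary-or-reducible (lead2 {y}) = inj₂ (-, stepI y)
binary-or-reducible (lead1 {t}) =
  Sum.map₂ (λ viol → violation-reducible viol lead1) (all-or-violation (λ d → ¬? (d ≟ d2)) t λ ())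

noZero-or-coreducible : ∀ {w} → LeadNZ w → NoZero w ⊎ ∃[ v ] v ⟶ w
noZero-or-coreducible {c ∷ t} l =
  Sum.map₂ violation-coreducible (all-or-violation (λ d → ¬? (d ≟ d0)) t (nonzero-lead l))

module Normalisation {_↝_ : Word → Word → Set} {P Q : Word → Set}
  (↝-preserves : ∀ {w v} → w ↝ v → P w → P v)
  (Q-or-reducible : ∀ {w} → P w → Q w ⊎ ∃[ v ] w ↝ v)
  where

  ↝*-preserves : ∀ {w v} → Star _↝_ w v → P w → P v
  ↝*-preserves = fold (λ w v → P w → P v) (λ st f → f ∘ ↝-preserves st) id

  irreducible-reduct : ∀ {w v} → P w → Star _↝_ w v → Irreducible _↝_ v → P v × Q v
  irreducible-reduct pw w↝*v irr with pv ← ↝*-preserves w↝*v pw | Q-or-reducible pv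
  ... | inj₁ qv = pv , qv
  ... | inj₂ (u , st) = ⊥-elim (irr u st)

  normalise : ∀ {w} → Acc (flip _↝_) w → P w → ∃[ v ] Star _↝_ w v × P v × Q v
  normalise {w} (acc rs) pw with Q-or-reducible pw
  ... | inj₁ qw = w , ε , pw , qw
  ... | inj₂ (u , st) with v , u↝*v , pv , qv ← normalise (rs st) (↝-preserves st pw) =
    v , st ◅ u↝*v , pv , qv

module Reduction (n : ℕ) =
  Normalisation {_⟶_} {IsHyper n} {Binary} ⟶-IsHyper (binary-or-reducible ∘ proj₁)

module InverseReduction (n : ℕ) =
  Normalisation {_⟶⁻_} {IsHyper n} {NoZero} ⟵-IsHyper (noZero-or-coreducible ∘ proj₁)

odd≢even : ∀ a b → 2 * a + 1 ≢ 2 * b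
odd≢even a b e = even≢odd b a (trans (sym e) (+-comm (2 * a) 1))

2*-suc : ∀ b → 2 * b + 2 ≡ 2 * suc b
2*-suc = solve-∀

head-∷ʳ⁻ : ∀ xs {x} → head (xs ∷ʳ x) ≢ just d0 → head xs ≢ just d0
head-∷ʳ⁻ [] _ ()
head-∷ʳ⁻ (a ∷ xs) h = h

lead⇒head : ∀ {w} → LeadNZ w → head w ≢ just d0
lead⇒head lead1 ()
lead⇒head lead2 ()

module Uniqueness {P : Digit → Set} (¬0∧2 : P d0 → P d2 → ⊥) where

  digit-cancel : ∀ {a b c d} → P c → P d → 2 * a + digitVal c ≡ 2 * b + digitVal d → c ≡ d × a ≡ b
  digit-cancel {a} {b} {d0} {d0} _ _ e = refl , *-cancelˡ-≡ a b 2 (+-cancelʳ-≡ 0 _ _ e)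
  digit-cancel {a} {b} {d1} {d1} _ _ e = refl , *-cancelˡ-≡ a b 2 (+-cancelʳ-≡ 1 _ _ e)
  digit-cancel {a} {b} {d2} {d2} _ _ e = refl , *-cancelˡ-≡ a b 2 (+-cancelʳ-≡ 2 _ _ e)
  digit-cancel {c = d0} {d2} p0 p2 _ = ⊥-elim (¬0∧2 p0 p2)
  digit-cancel {c = d2} {d0} p2 p0 _ = ⊥-elim (¬0∧2 p0 p2)
  digit-cancel {a} {b} {d0} {d1} _ _ e = ⊥-elim (odd≢even b a (trans (sym e) (+-identityʳ _)))
  digit-cancel {a} {b} {d1} {d0} _ _ e = ⊥-elim (odd≢even a b (trans e (+-identityʳ _)))
  digit-cancel {a} {b} {d1} {d2} _ _ e = ⊥-elim (odd≢even a (suc b) (trans e (2*-suc b)))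
  digit-cancel {a} {b} {d2} {d1} _ _ e = ⊥-elim (odd≢even b (suc a) (trans (sym e) (2*-suc a)))

  value-injective : ∀ {u v} → Reverse u → Reverse v → All P u → All P v →
                    head u ≢ just d0 → head v ≢ just d0 → value u ≡ value v → u ≡ v
  value-injective [] _ _ _ _ hv e = sym (value≡0⇒[] _ hv (sym e))
  value-injective (_ ∶ _ ∶ʳ _) [] _ _ hu _ e = value≡0⇒[] _ hu e
  value-injective (xs ∶ rxs ∶ʳ x) (ys ∶ rys ∶ʳ y) pu pv hu hv e
    with pxs , px ← ∷ʳ⁻ pu | pys , py ← ∷ʳ⁻ pv
    with refl , e′ ← digit-cancel px py (trans (sym (value-∷ʳ xs x)) (trans e (value-∷ʳ ys y))) =
    cong (_∷ʳ x) (value-injective rxs rys pxs pys (head-∷ʳ⁻ xs hu) (head-∷ʳ⁻ ys hv) e′)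

  expansion-unique : ∀ {n u v} → IsHyper n u → All P u → IsHyper n v → All P v → u ≡ v
  expansion-unique (lu , eu) pu (lv , ev) pv =
    value-injective (reverseView _) (reverseView _) pu pv (lead⇒head lu) (lead⇒head lv) (trans eu (sym ev))

binary-unique : ∀ {n u v} → IsHyper n u → Binary u → IsHyper n v → Binary v → u ≡ v
binary-unique = Uniqueness.expansion-unique λ _ 2≢2 → 2≢2 refl

noZero-unique : ∀ {n u v} → IsHyper n u → NoZero u → IsHyper n v → NoZero v → u ≡ v
noZero-unique = Uniqueness.expansion-unique λ 0≢0 _ → 0≢0 refl

raise-last : ∀ {n} xs {d d′} → d′ ≢ d0 → digitVal d′ ≡ suc (digitVal d) →
             IsHyper n (xs ∷ʳ d) → IsHyper (suc n) (xs ∷ʳ d′)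
raise-last {n} xs {d} {d′} d′≢0 raise (l , e) = lead xs l , value-raised
  where
  lead : ∀ ys → LeadNZ (ys ∷ʳ d) → LeadNZ (ys ∷ʳ d′)
  lead [] _ = lead-nonzero d′≢0
  lead (a ∷ ys) l = lead-nonzero (nonzero-lead l)
  value-raised : value (xs ∷ʳ d′) ≡ suc n
  value-raised = begin
    value (xs ∷ʳ d′)                ≡⟨ value-∷ʳ xs d′ ⟩
    2 * value xs + digitVal d′      ≡⟨ cong (2 * value xs +_) raise ⟩
    2 * value xs + suc (digitVal d) ≡⟨ +-suc _ _ ⟩
    suc (2 * value xs + digitVal d) ≡⟨ cong suc (trans (sym (value-∷ʳ xs d)) e) ⟩
    suc n                           ∎
    where open ≡-Reasoning

expansion-of-suc : ∀ {n u} → IsHyper n u → Binary u → ∃[ u′ ] IsHyper (suc n) u′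
expansion-of-suc {u = u} h b with initLast u
expansion-of-suc (() , _) _ | []
expansion-of-suc h _ | xs ∷ʳ′ d0 = -, raise-last xs {d′ = d1} (λ ()) refl h
expansion-of-suc h _ | xs ∷ʳ′ d1 = -, raise-last xs {d′ = d2} (λ ()) refl h
expansion-of-suc h b | xs ∷ʳ′ d2 with () ← proj₂ (∷ʳ⁻ b) refl

binary-expansion : ∀ m → ∃[ u ] IsHyper (suc m) u × Binary u
binary-expansion zero = d1 ∷ [] , (lead1 , refl) , (λ ()) ∷ []
binary-expansion (suc m)
  with u , hu , bu ← binary-expansion m
  with u′ , hu′ ← expansion-of-suc hu bu
  with v , _ , hv , bv ← Reduction.normalise (suc (suc m)) (⟶-wellFounded u′) hu′ = v , hv , bv

noZero-expansion : ∀ m → ∃[ u ] IsHyper (suc m) u × NoZero u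
noZero-expansion m
  with u , hu , _ ← binary-expansion m
  with v , _ , hv , zv ← InverseReduction.normalise (suc m) (⟶⁻-wellFounded u) hu = v , hv , zv

binary-shortlex-maximum : ∀ {n u} → IsHyper n u → Binary u → ∀ w → IsHyper n w → w ≤SL u
binary-shortlex-maximum {n} hu bu w hw
  with v , w⟶*v , hv , bv ← Reduction.normalise n (⟶-wellFounded w) hw =
  subst (w ≤SL_) (binary-unique hv bv hu bu) (⟶*⇒≤SL w⟶*v)

noZero-shortlex-minimum : ∀ {n u} → IsHyper n u → NoZero u → ∀ w → IsHyper n w → u ≤SL w
noZero-shortlex-minimum {n} hu zu w hw
  with v , w⟶⁻*v , hv , zv ← InverseReduction.normalise n (⟶⁻-wellFounded w) hw =
  subst (_≤SL w) (noZero-unique hv zv hu zu) (⟶*⇒≤SL (reverse id w⟶⁻*v))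

corollary2p7 : ∀ (n : ℕ) → 1 ≤ n →
    (∀ (w : Word) → IsHyper n w →
      (Acc (flip _⟶_) w
        × (∀ v → Star _⟶_ w v → Irreducible _⟶_ v → IsHyper n v × Binary v))
      × (Acc (flip _⟶⁻_) w
        × (∀ v → Star _⟶⁻_ w v → Irreducible _⟶⁻_ v → IsHyper n v × NoZero v)))
    × ((Σ Word (λ u → IsHyper n u × NoZero u))
      × (∀ u → IsHyper n u → NoZero u → ∀ w → IsHyper n w → u ≤SL w))
    × ((Σ Word (λ u → IsHyper n u × Binary u))
      × (∀ u → IsHyper n u → Binary u → ∀ w → IsHyper n w → w ≤SL u))
corollary2p7 n@(suc m) _ =
    (λ w hw →
        (⟶-wellFounded w , λ v → Reduction.irreducible-reduct n hw)
      , (⟶⁻-wellFounded w , λ v → InverseReduction.irreducible-reduct n hw))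
  , (noZero-expansion m , λ u → noZero-shortlex-minimum)
  , (binary-expansion m , λ u → binary-shortlex-maximum)
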